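{- Every closed formula $\varphi$ of $L^\mu_4$ is semantically equivalent to a closed formula $\psi$ of $L^\infty_4$, i.e. in every transition system, $\varphi$ and $\psi$ define the same set of states.
   Context: A transition system is $(Q,\delta,[\![\cdot]\!],\mathcal{O})$ with state space $Q$, successor function $\delta:Q\to 2^Q$, finite set of observables $\mathcal{O}$, and extensions $[\![\cdot]\!]:\mathcal{O}\to 2^Q$. $L^\mu_4$ (existential conjunction-free fragment of the $\mu$-calculus) consists of the closed formulas generated by $\varphi ::= p\mid h\mid\varphi\vee\varphi\mid\exists\bigcirc\varphi\mid(\mu h:\varphi)$, $p$ an observable and $h$ a variable. Semantics relative to an environment $\mathcal{E}$ mapping variables to sets of states: $[\![p]\!]_\mathcal{E}=[\![p]\!]$, $[\![h]\!]_\mathcal{E}=\mathcal{E}(h)$, $[\![\varphi_1\vee\varphi_2]\!]_\mathcal{E}=[\![\varphi_1]\!]_\mathcal{E}\cup[\![\varphi_2]\!]_\mathcal{E}$, $[\![\exists\bigcirc\varphi]\!]_\mathcal{E}=\{s\in Q:\exists s'\in\delta(s),\ s'\in[\![\varphi]\!]_\mathcal{E}\}$, $[\![\mu h:\varphi]\!]_\mathcal{E}=\bigcap\{\tau\subseteq Q:\tau=[\![\varphi]\!]_{\mathcal{E}[h\mapsto\tau]}\}$. $L^\infty_4$: its open formulas are generated by $\psi ::= \bigvee_i\psi'_i$ and $\psi' ::= p\mid h\mid\exists\bigcirc\psi'$, where $\bigvee_i\psi'_i$ denotes any countable (possibly empty) disjunction of formulas of the form $\psi'$. Semantics: $[\![p]\!]_\mathcal{E}=[\![p]\!]$,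 $[\![h]\!]_\mathcal{E}=\mathcal{E}(h)$, $[\![\exists\bigcirc\psi]\!]_\mathcal{E}=\{s:\exists s'\in\delta(s),\ s'\in[\![\psi]\!]_\mathcal{E}\}$, $[\![\bigvee_i\psi_i]\!]_\mathcal{E}=\bigcup_i[\![\psi_i]\!]_\mathcal{E}$. A formula is closed if it has no free variables $h$; the set it defines is then independent of $\mathcal{E}$. -}

module Defs where

open import Level using (Level; Lift; lift; _⊔_) renaming (zero to lzero; suc to lsuc)
open import Data.Nat using (ℕ; zero; suc)
open import Data.Fin using (Fin)
open import Data.Maybe using (Maybe; just; nothing)
open import Data.Product using (Σ; ∃; _×_; _,_)
open import Data.Sum using (_⊎_)
open import Function.Bundles using (_⇔_)

record TS (k : ℕ) : Set₁ where
  field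
    Q   : Set
    δ   : Q → Q → Set          -- δ s s'  means  s' ∈ δ(s)
    ext : Fin k → Q → Set

open TS public

-- L^μ_4 : formulas with de Bruijn variables; Mu k n has free vars in Fin n.
-- Closed formulas are  Mu k 0.

data Mu (k : ℕ) : ℕ → Set where
  obs  : ∀ {n} → Fin k → Mu k n
  var  : ∀ {n} → Fin n → Mu k n
  _∨_  : ∀ {n} → Mu k n → Mu k n → Mu k n
  ex○  : ∀ {n} → Mu k n → Mu k n
  μ    : ∀ {n} → Mu k (suc n) → Mu k n     -- μ h : φ, binding variable 0

Env : ∀ {k} → TS k → ℕ → Set₁
Env T n = Fin n → (Q T → Set)

extend : ∀ {k} {T : TS k} {n} → (Q T → Set) → Env T n → Env T (suc n)
extend τ E Fin.zero = τ
extend τ E (Fin.suc i) = E i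

semMu : ∀ {k} (T : TS k) {n} → Mu k n → Env T n → Q T → Set₁
semMu T (obs p)   E s = Lift (lsuc lzero) (ext T p s)
semMu T (var i)   E s = Lift (lsuc lzero) (E i s)
semMu T (φ ∨ ψ)   E s = semMu T φ E s ⊎ semMu T ψ E s
semMu T (ex○ φ)   E s = Σ (Q T) λ s' → Lift (lsuc lzero) (δ T s s') × semMu T φ E s'
semMu T (μ φ)     E s =
  (τ : Q T → Set) → (∀ q → τ q ⇔ semMu T φ (extend {T = T} τ E) q) → τ s

-- L^∞_4.  ψ' ::= p | h | ∃○ψ'   and  ψ ::= ⋁_i ψ'_i  (countable, possibly empty).

data Atom (k : ℕ) (n : ℕ) : Set where
  obs : Fin k → Atom k n
  var : Fin n → Atom k n
  ex○ : Atom k n → Atom k n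

-- A countable (possibly empty, possibly finite) disjunction, given as an
-- ℕ-indexed family of optional disjuncts (nothing = no disjunct at that index).
record Inf (k : ℕ) (n : ℕ) : Set where
  constructor ⋁
  field
    disj : ℕ → Maybe (Atom k n)

semAtom : ∀ {k} (T : TS k) {n} → Atom k n → Env T n → Q T → Set
semAtom T (obs p) E s = ext T p s
semAtom T (var i) E s = E i s
semAtom T (ex○ a) E s = Σ (Q T) λ s' → δ T s s' × semAtom T a E s'

semMaybe : ∀ {k} (T : TS k) {n} → Maybe (Atom k n) → Env T n → Q T → Set
semMaybe T (just a) E s = semAtom T a E s
semMaybe T nothing  E s = Lift lzero (Data.Empty.⊥)
  where import Data.Empty

semInf : ∀ {k} (T : TS k) {n} → Inf k n → Env T n → Q T → Set
semInf T (⋁ f) E s = ∃ λ i → semMaybe T (f i) E s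

ε : ∀ {k} {T : TS k} → Env T 0
ε ()

{-# OPTIONS --safe #-}
-- Translate by structural recursion; only μ needs an argument. An L^∞_4 formula ψ(h) is
-- monotone in h, and it commutes with countable unions of the value of h, because each
-- disjunct ∃○ … ∃○ ℓ ends in a single leaf ℓ. By Kleene's argument the union of the
-- approximants ψ^j(∅) is then a fixed point of τ ↦ ψ(τ) lying below every prefixed point,
-- so it is the intersection of all fixed points, i.e. μh.ψ. Each approximant is an L^∞_4
-- formula by substitution, and a countable union of countable disjunctions is again one
-- by pairing.
module Submission where

open import Defs
open import Level using (0ℓ; lift; lower)
open import Data.Nat using (ℕ; zero; suc; _+_)
open import Data.Nat.Properties using (+-identityʳ; +-suc)
open import Data.Fin using (Fin)
open import Data.Maybe as Maybe using (Maybe; just; nothing; maybe′)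
open import Data.Product using (Σ; ∃; _×_; _,_; proj₁; proj₂)
open import Data.Sum as ⊎ using (inj₁; inj₂)
open import Function using (_∘_; id)
open import Function.Bundles using (_⇔_; mk⇔; Equivalence)
open import Relation.Binary.PropositionalEquality using (_≡_; refl; cong; sym; subst)
open import Relation.Unary using (Pred; _⊆_; _≐_; ∅; ⋃; _∪_)
open import Relation.Unary.Properties using (≐-refl; ≐-sym; ≐-trans)

-- unpair enumerates ℕ × ℕ along the anti-diagonals a + b = d, from (d , 0) to (0 , d).
zigzag : ℕ × ℕ → ℕ × ℕ
zigzag (zero  , b) = suc b , zero
zigzag (suc a , b) = a , suc b

unpair : ℕ → ℕ × ℕ
unpair zero    = zero , zero
unpair (suc n) = zigzag (unpair n)

unpair-walk : ∀ c {n a b} → unpair n ≡ (a + c , b) → unpair (c + n) ≡ (a , b + c)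
unpair-walk zero    {a = a} {b} eq rewrite +-identityʳ a | +-identityʳ b = eq
unpair-walk (suc c) {a = a} {b} eq rewrite +-suc a c | +-suc b c = cong zigzag (unpair-walk c eq)

unpair-diagonal : ∀ d → ∃ λ n → unpair n ≡ (d , zero)
unpair-diagonal zero = zero , refl
unpair-diagonal (suc d) with unpair-diagonal d
... | n , eq = suc (d + n) , cong zigzag (unpair-walk d eq)

unpair-surjective : ∀ a b → ∃ λ n → unpair n ≡ (a , b)
unpair-surjective a b with unpair-diagonal (a + b)
... | n , eq = b + n , unpair-walk b eq

∪-cong : ∀ {a ℓ₁ ℓ₂ ℓ₃ ℓ₄} {A : Set a}
         {P : Pred A ℓ₁} {P′ : Pred A ℓ₂} {R : Pred A ℓ₃} {R′ : Pred A ℓ₄} →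
         P ≐ P′ → R ≐ R′ → P ∪ R ≐ P′ ∪ R′
∪-cong (P⊆P′ , P′⊆P) (R⊆R′ , R′⊆R) = ⊎.map P⊆P′ R⊆R′ , ⊎.map P′⊆P R′⊆R

⋃-cong : ∀ {a i ℓ} {A : Set a} {I : Set i} {P P′ : I → Pred A ℓ} →
         (∀ i → P i ≐ P′ i) → ⋃ I P ≐ ⋃ I P′
⋃-cong P≐P′ = (λ (i , x) → i , proj₁ (P≐P′ i) x) , (λ (i , x) → i , proj₂ (P≐P′ i) x)

module Kleene {a} {A : Set a} (F : Pred A 0ℓ → Pred A 0ℓ)
  (F-mono : ∀ {P P′} → P ⊆ P′ → F P ⊆ F P′)
  (F-⋃ : (P : ℕ → Pred A 0ℓ) → F (⋃[ j ∶ ℕ ] P j) ⊆ ⋃[ j ∶ ℕ ] F (P j))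
  where

  approx : ℕ → Pred A 0ℓ
  approx zero    = ∅
  approx (suc j) = F (approx j)

  lfp : Pred A 0ℓ
  lfp = ⋃[ j ∶ ℕ ] approx j

  lfp-fixed : F lfp ≐ lfp
  lfp-fixed = (λ x → let (j , y) = F-⋃ approx x in suc j , y)
            , (λ { (zero , ()) ; (suc j , y) → F-mono (j ,_) y })

  lfp-least : ∀ {τ} → F τ ⊆ τ → lfp ⊆ τ
  lfp-least {τ} Fτ⊆τ (j , x) = approx⊆τ j x
    where
    approx⊆τ : ∀ j → approx j ⊆ τ
    approx⊆τ zero    ()
    approx⊆τ (suc j) x = Fτ⊆τ (F-mono (approx⊆τ j) x)

  lfp≐⋂-fixed-points : ∀ {ℓ} (G : Pred A 0ℓ → Pred A ℓ) → (∀ τ → G τ ≐ F τ) →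
                       lfp ≐ (λ s → (τ : Pred A 0ℓ) → (∀ q → τ q ⇔ G τ q) → τ s)
  lfp≐⋂-fixed-points G G≐F = lfp⊆fixed-point , (λ x → x lfp lfp-fixed-by-G)
    where
    lfp⊆fixed-point : ∀ {s} → lfp s → (τ : Pred A 0ℓ) → (∀ q → τ q ⇔ G τ q) → τ s
    lfp⊆fixed-point x τ τ-fixed = lfp-least (Equivalence.from (τ-fixed _) ∘ proj₂ (G≐F τ)) x
    lfp-fixed-by-G : ∀ q → lfp q ⇔ G lfp q
    lfp-fixed-by-G q = mk⇔ (proj₂ (G≐F lfp) ∘ proj₂ lfp-fixed)
                           (proj₁ lfp-fixed ∘ proj₁ (G≐F lfp))

module _ {k n : ℕ} where

  ∅ᴵ : Inf k n
  ∅ᴵ = ⋁ λ _ → nothing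

  ⟨_⟩ : Atom k n → Inf k n
  ⟨ a ⟩ = ⋁ λ _ → just a

  ⋃ᴵ : (ℕ → Inf k n) → Inf k n
  ⋃ᴵ F = ⋁ λ m → let (i , j) = unpair m in Inf.disj (F i) j

  either : Inf k n → Inf k n → ℕ → Inf k n
  either ψ χ zero    = ψ
  either ψ χ (suc _) = χ

  _∪ᴵ_ : Inf k n → Inf k n → Inf k n
  ψ ∪ᴵ χ = ⋃ᴵ (either ψ χ)

  ∃○ᴵ : Inf k n → Inf k n
  ∃○ᴵ (⋁ f) = ⋁ (Maybe.map ex○ ∘ f)

substAtom : ∀ {k n} → Atom k (suc n) → Inf k n → Inf k n
substAtom (obs p)           G = ⟨ obs p ⟩
substAtom (var Fin.zero)    G = G
substAtom (var (Fin.suc i)) G = ⟨ var i ⟩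
substAtom (ex○ a)           G = ∃○ᴵ (substAtom a G)

substInf : ∀ {k n} → Inf k (suc n) → Inf k n → Inf k n
substInf (⋁ f) G = ⋃ᴵ λ i → maybe′ (λ a → substAtom a G) ∅ᴵ (f i)

approxᴵ : ∀ {k n} → Inf k (suc n) → ℕ → Inf k n
approxᴵ ψ zero    = ∅ᴵ
approxᴵ ψ (suc j) = substInf ψ (approxᴵ ψ j)

translate : ∀ {k n} → Mu k n → Inf k n
translate (obs p) = ⟨ obs p ⟩
translate (var i) = ⟨ var i ⟩
translate (φ ∨ ψ) = translate φ ∪ᴵ translate ψ
translate (ex○ φ) = ∃○ᴵ (translate φ)
translate (μ φ)   = ⋃ᴵ (approxᴵ (translate φ))

module Semantics {k : ℕ} (T : TS k) where

  ◇ : Pred (Q T) 0ℓ → Pred (Q T) 0ℓ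
  ◇ P s = Σ (Q T) λ s′ → δ T s s′ × P s′

  ◇-cong : ∀ {P P′} → P ≐ P′ → ◇ P ≐ ◇ P′
  ◇-cong (P⊆P′ , P′⊆P) = (λ (s′ , d , x) → s′ , d , P⊆P′ x)
                       , (λ (s′ , d , x) → s′ , d , P′⊆P x)

  semMu-ex○ : ∀ {n} (φ : Mu k n) {E P} → semMu T φ E ≐ P → semMu T (ex○ φ) E ≐ ◇ P
  semMu-ex○ φ (φ⊆P , P⊆φ) = (λ (s′ , lift d , x) → s′ , d , φ⊆P x)
                          , (λ (s′ , d , x) → s′ , lift d , P⊆φ x)

  module _ {n : ℕ} (E : Env T n) where

    semInf-∅ᴵ : semInf T ∅ᴵ E ≐ ∅
    semInf-∅ᴵ = (λ { (_ , lift ()) }) , λ ()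

    semInf-⟨⟩ : ∀ a → semInf T ⟨ a ⟩ E ≐ semAtom T a E
    semInf-⟨⟩ a = proj₂ , (zero ,_)

    semInf-⋃ᴵ : ∀ F → semInf T (⋃ᴵ F) E ≐ ⋃[ i ∶ ℕ ] semInf T (F i) E
    semInf-⋃ᴵ F = (λ (m , x) → proj₁ (unpair m) , proj₂ (unpair m) , x) , from
      where
      from : ⋃[ i ∶ ℕ ] semInf T (F i) E ⊆ semInf T (⋃ᴵ F) E
      from (i , j , x) with unpair-surjective i j
      ... | m , eq = m , subst (λ (i , j) → semMaybe T (Inf.disj (F i) j) E _) (sym eq) x

    semInf-∪ᴵ : ∀ ψ χ → semInf T (ψ ∪ᴵ χ) E ≐ semInf T ψ E ∪ semInf T χ E
    semInf-∪ᴵ ψ χ = split ∘ proj₁ (semInf-⋃ᴵ (either ψ χ))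
                  , proj₂ (semInf-⋃ᴵ (either ψ χ)) ∘ join
      where
      split : ⋃[ i ∶ ℕ ] semInf T (either ψ χ i) E ⊆ semInf T ψ E ∪ semInf T χ E
      split (zero  , x) = inj₁ x
      split (suc _ , x) = inj₂ x
      join : semInf T ψ E ∪ semInf T χ E ⊆ ⋃[ i ∶ ℕ ] semInf T (either ψ χ i) E
      join (inj₁ x) = zero , x
      join (inj₂ x) = suc zero , x

    semInf-∃○ᴵ : ∀ ψ → semInf T (∃○ᴵ ψ) E ≐ ◇ (semInf T ψ E)
    semInf-∃○ᴵ (⋁ f) = (λ (i , x) → let (s′ , d , y) = under (f i) x in s′ , d , i , y)
                     , (λ (s′ , d , i , y) → i , over (f i) (s′ , d , y))
      where
      under : ∀ m → semMaybe T (Maybe.map ex○ m) E ⊆ ◇ (semMaybe T m E)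
      under (just a) x = x
      under nothing  (lift ())
      over : ∀ m → ◇ (semMaybe T m E) ⊆ semMaybe T (Maybe.map ex○ m) E
      over (just a) x = x
      over nothing  (_ , _ , lift ())

  semInf-substAtom : ∀ {n} (a : Atom k (suc n)) G (E : Env T n) →
                     semInf T (substAtom a G) E ≐ semAtom T a (extend {T = T} (semInf T G E) E)
  semInf-substAtom (obs p)           G E = semInf-⟨⟩ E (obs p)
  semInf-substAtom (var Fin.zero)    G E = ≐-refl
  semInf-substAtom (var (Fin.suc i)) G E = semInf-⟨⟩ E (var i)
  semInf-substAtom (ex○ a)           G E =
    ≐-trans (semInf-∃○ᴵ E (substAtom a G)) (◇-cong (semInf-substAtom a G E))

  semInf-substInf : ∀ {n} (ψ : Inf k (suc n)) G (E : Env T n) →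
                    semInf T (substInf ψ G) E ≐ semInf T ψ (extend {T = T} (semInf T G E) E)
  semInf-substInf {n} (⋁ f) G E =
    ≐-trans (semInf-⋃ᴵ E (substMaybe ∘ f)) (⋃-cong (substMaybe-correct ∘ f))
    where
    substMaybe : Maybe (Atom k (suc n)) → Inf k n
    substMaybe = maybe′ (λ a → substAtom a G) ∅ᴵ
    substMaybe-correct : ∀ m → semInf T (substMaybe m) E ≐ semMaybe T m (extend {T = T} (semInf T G E) E)
    substMaybe-correct (just a) = semInf-substAtom a G E
    substMaybe-correct nothing  = (λ { (_ , lift ()) }) , λ { (lift ()) }

  semAtom-mono : ∀ {n} (a : Atom k n) {E E′ : Env T n} →
                 (∀ i → E i ⊆ E′ i) → semAtom T a E ⊆ semAtom T a E′
  semAtom-mono (obs p) E⊆E′ x = x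
  semAtom-mono (var i) E⊆E′ x = E⊆E′ i x
  semAtom-mono (ex○ a) E⊆E′ (s′ , d , x) = s′ , d , semAtom-mono a E⊆E′ x

  semInf-mono : ∀ {n} (ψ : Inf k n) {E E′ : Env T n} →
                (∀ i → E i ⊆ E′ i) → semInf T ψ E ⊆ semInf T ψ E′
  semInf-mono (⋁ f) {E} {E′} E⊆E′ (i , x) = i , semMaybe-mono (f i) x
    where
    semMaybe-mono : ∀ m → semMaybe T m E ⊆ semMaybe T m E′
    semMaybe-mono (just a) = semAtom-mono a E⊆E′
    semMaybe-mono nothing  = id

  semAtom-⋃ : ∀ {n} (a : Atom k n) (Es : ℕ → Env T n) →
              semAtom T a (λ i → ⋃[ j ∶ ℕ ] Es j i) ⊆ ⋃[ j ∶ ℕ ] semAtom T a (Es j)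
  semAtom-⋃ (obs p) Es x = zero , x
  semAtom-⋃ (var i) Es x = x
  semAtom-⋃ (ex○ a) Es (s′ , d , x) = let (j , y) = semAtom-⋃ a Es x in j , s′ , d , y

  semInf-⋃ : ∀ {n} (ψ : Inf k n) (Es : ℕ → Env T n) →
             semInf T ψ (λ i → ⋃[ j ∶ ℕ ] Es j i) ⊆ ⋃[ j ∶ ℕ ] semInf T ψ (Es j)
  semInf-⋃ (⋁ f) Es (i , x) = let (j , y) = semMaybe-⋃ (f i) x in j , i , y
    where
    semMaybe-⋃ : ∀ m → semMaybe T m (λ i → ⋃[ j ∶ ℕ ] Es j i) ⊆ ⋃[ j ∶ ℕ ] semMaybe T m (Es j)
    semMaybe-⋃ (just a) = semAtom-⋃ a Es
    semMaybe-⋃ nothing  (lift ())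

  module Unfolding {n} (ψ : Inf k (suc n)) (E : Env T n) where

    F : Pred (Q T) 0ℓ → Pred (Q T) 0ℓ
    F τ = semInf T ψ (extend {T = T} τ E)

    F-mono : ∀ {τ τ′} → τ ⊆ τ′ → F τ ⊆ F τ′
    F-mono τ⊆τ′ = semInf-mono ψ λ { Fin.zero → τ⊆τ′ ; (Fin.suc i) → id }

    F-⋃ : (P : ℕ → Pred (Q T) 0ℓ) → F (⋃[ j ∶ ℕ ] P j) ⊆ ⋃[ j ∶ ℕ ] F (P j)
    F-⋃ P = semInf-⋃ ψ (λ j → extend {T = T} (P j) E)
          ∘ semInf-mono ψ λ { Fin.zero → id ; (Fin.suc i) → zero ,_ }

    open Kleene F F-mono F-⋃ public

    semInf-approxᴵ : ∀ j → semInf T (approxᴵ ψ j) E ≐ approx j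
    semInf-approxᴵ zero    = semInf-∅ᴵ E
    semInf-approxᴵ (suc j) =
      let (ψⱼ⊆approx , approx⊆ψⱼ) = semInf-approxᴵ j
      in ≐-trans (semInf-substInf ψ (approxᴵ ψ j) E) (F-mono ψⱼ⊆approx , F-mono approx⊆ψⱼ)

    semInf-⋃ᴵapproxᴵ : semInf T (⋃ᴵ (approxᴵ ψ)) E ≐ lfp
    semInf-⋃ᴵapproxᴵ = ≐-trans (semInf-⋃ᴵ E (approxᴵ ψ)) (⋃-cong semInf-approxᴵ)

  translate-correct : ∀ {n} (φ : Mu k n) (E : Env T n) → semMu T φ E ≐ semInf T (translate φ) E
  translate-correct (obs p) E = ≐-trans (lower , lift) (≐-sym (semInf-⟨⟩ E (obs p)))
  translate-correct (var i) E = ≐-trans (lower , lift) (≐-sym (semInf-⟨⟩ E (var i)))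
  translate-correct (φ ∨ χ) E =
    ≐-trans (∪-cong (translate-correct φ E) (translate-correct χ E))
            (≐-sym (semInf-∪ᴵ E (translate φ) (translate χ)))
  translate-correct (ex○ φ) E =
    ≐-trans (semMu-ex○ φ (translate-correct φ E)) (≐-sym (semInf-∃○ᴵ E (translate φ)))
  translate-correct (μ φ)   E =
    ≐-trans (≐-sym (lfp≐⋂-fixed-points (λ τ → semMu T φ (extend {T = T} τ E))
                                       (λ τ → translate-correct φ (extend {T = T} τ E))))
            (≐-sym semInf-⋃ᴵapproxᴵ)
    where open Unfolding (translate φ) E

proposition4 : (k : ℕ) (φ : Mu k 0) →
    Σ (Inf k 0) λ ψ →
      (T : TS k) (s : Q T) → semMu T φ (ε {T = T}) s ⇔ semInf T ψ (ε {T = T}) s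
proposition4 k φ = translate φ , λ T s →
  let (sound , complete) = Semantics.translate-correct T φ (ε {T = T}) in mk⇔ sound complete
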